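{- Let $p$ be an odd prime and $z\in\mathbb{F}_p$ with $z\neq0,-4$ such that $z^2+4z$ is a square in $\mathbb{F}_p$. Then the two elements $\frac{ -(z+2)\pm\sqrt{z^2+4z}}{2}$ of $\mathbb{F}_p^*$ both have multiplicative order $\alpha(z,p)$.
   Context: $\mathbb{F}$ is an algebraic closure of $\mathbb{F}_p$. For $x,y\in\mathbb{F}$, $[i,j]:=x^{p^i}y^{p^j}-x^{p^j}y^{p^i}$ and, for $x,y$ linearly independent over $\mathbb{F}_p$, $\nu(x,y):=-\frac{[0,2][1,3]}{[0,1][2,3]}$. For $m\ge1$, $\mathcal{Z}(m)=\{\nu(x,y):x,y\in\mathbb{F}_{p^m}\text{ lin. indep. over }\mathbb{F}_p\}$, $f_{m,p}(X)=\prod_{w\in\mathcal{Z}(m)\setminus\{0\}}(X-w)$. The order of appearance $\alpha(z,p)$ is the least $m\ge1$ with $f_{m,p}(z)=0$. -}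

module Defs where

open import Level using (Level; _⊔_)
open import Data.Nat as ℕ using (ℕ; zero; suc; _<_; _≤_)
open import Data.List using (List; []; _∷_)
open import Data.Product using (Σ; ∃; _×_; _,_)
open import Relation.Nullary using (¬_)
open import Algebra.Bundles using (CommutativeRing)

module _ {c ℓ : Level} (F : CommutativeRing c ℓ) where
  open CommutativeRing F

  pow : Carrier → ℕ → Carrier
  pow x zero    = 1#
  pow x (suc n) = x * pow x n

  nat : ℕ → Carrier
  nat zero    = 0#
  nat (suc n) = 1# + nat n

  -- evaluation of the polynomial X^d + c_{d-1} X^{d-1} + ... + c_0 given
  -- coefficient list [c_0, ..., c_{d-1}] (monic, degree = length of list)
  evalMonic : List Carrier → Carrier → Carrier
  evalMonic []       x = 1#
  evalMonic (a ∷ as) x = a + x * evalMonic as x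

  IsField : Set (c ⊔ ℓ)
  IsField = (¬ (1# ≈ 0#)) × (∀ x → ¬ (x ≈ 0#) → ∃ λ y → x * y ≈ 1#)

  IsAlgClosed : Set (c ⊔ ℓ)
  IsAlgClosed = ∀ (a : Carrier) (as : List Carrier) → ∃ λ x → evalMonic (a ∷ as) x ≈ 0#

  HasChar : ℕ → Set ℓ
  HasChar p = nat p ≈ 0#

  -- F is an algebraic closure of F_p (algebraically closed field of char p;
  -- every algebraically closed field of char p contains an algebraic closure of F_p,
  -- and all the notions below only depend on the finite subfields F_{p^m})
  IsAlgClosedFieldOfChar : ℕ → Set (c ⊔ ℓ)
  IsAlgClosedFieldOfChar p = IsField × IsAlgClosed × HasChar p

  InFp : ℕ → Carrier → Set ℓ
  InFp p x = Σ ℕ λ n → (n < p) × (x ≈ nat n)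

  InFpm : ℕ → ℕ → Carrier → Set ℓ
  InFpm p m x = pow x (p ℕ.^ m) ≈ x

  LinIndep : ℕ → Carrier → Carrier → Set ℓ
  LinIndep p x y = ∀ (a b : ℕ) → nat a * x + nat b * y ≈ 0# → (nat a ≈ 0#) × (nat b ≈ 0#)

  bracket : ℕ → Carrier → Carrier → ℕ → ℕ → Carrier
  bracket p x y i j = pow x (p ℕ.^ i) * pow y (p ℕ.^ j) - pow x (p ℕ.^ j) * pow y (p ℕ.^ i)

  -- w = ν(x,y) = - [0,2][1,3] / ([0,1][2,3])   (denominator nonzero, w·den = -num)
  IsNu : ℕ → Carrier → Carrier → Carrier → Set ℓ
  IsNu p x y w =
    (¬ (bracket p x y 0 1 * bracket p x y 2 3 ≈ 0#)) ×
    (w * (bracket p x y 0 1 * bracket p x y 2 3)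
       ≈ - (bracket p x y 0 2 * bracket p x y 1 3))

  InZ : ℕ → ℕ → Carrier → Set (c ⊔ ℓ)
  InZ p m w = ∃ λ x → ∃ λ y →
    InFpm p m x × InFpm p m y × LinIndep p x y × IsNu p x y w

  -- f_{m,p}(z) = 0, i.e. z ∈ Z(m) \ {0}
  RootOf-f : ℕ → ℕ → Carrier → Set (c ⊔ ℓ)
  RootOf-f p m z = (¬ (z ≈ 0#)) × InZ p m z

  IsOrderOfAppearance : ℕ → Carrier → ℕ → Set (c ⊔ ℓ)
  IsOrderOfAppearance p z m =
    (1 ≤ m) × RootOf-f p m z × (∀ k → 1 ≤ k → RootOf-f p k z → m ≤ k)

  IsMultOrder : Carrier → ℕ → Set ℓ
  IsMultOrder r m = (1 ≤ m) × (pow r m ≈ 1#) × (∀ k → 1 ≤ k → pow r k ≈ 1# → m ≤ k)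

{-# OPTIONS --safe #-}
module Submission where

-- The hypotheses say that r is a root of X² + (z + 2) X + 1 lying in 𝔽ₚ, with
-- r ≠ 0, 1; write φᵢ x = x^(pⁱ). If t^(p-1) = r then φᵢ t = rⁱ t, so [i,j] = (rʲ - rⁱ) t
-- for x = 1, y = t, and ν(1,t) = z; moreover t ∈ 𝔽_{pᵐ} as soon as rᵐ = 1. Conversely let
-- z = ν(x,y) with x, y ∈ 𝔽_{pᵏ}. With Y = y/x and Wᵢ = φᵢ(Y^p - Y), the equation ν(x,y) = z
-- reads z Wᵢ Wᵢ₊₂ + (Wᵢ₊₁ + Wᵢ)(Wᵢ₊₂ + Wᵢ₊₁) = 0, and the quadratic equation for r turns
-- it into Aᵢ₊₁ Bᵢ = r Aᵢ Bᵢ₊₁ for Aᵢ = Wᵢ₊₁ - r Wᵢ, Bᵢ = r Wᵢ₊₁ - Wᵢ. As Aᵢ = φᵢ A₀,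
-- Bᵢ = φᵢ B₀ and W is k-periodic, this forces rᵏ = 1 whether A₀ or B₀ vanishes or not.

open import Defs
open import Level using (Level)
open import Algebra.Bundles using (CommutativeRing)
import Algebra.Properties.CommutativeSemiring.Binomial
import Algebra.Properties.CommutativeSemiring.Exp
import Algebra.Properties.Monoid.Sum
import Algebra.Properties.Semiring.Mult
import Algebra.Solver.Ring.AlmostCommutativeRing as ACR
open import Data.Empty using (⊥-elim)
open import Data.Fin as Fin using (Fin; toℕ; inject₁; fromℕ)
import Data.Fin.Properties as Fin
open import Data.Integer as ℤ using (ℤ; +_; -[1+_])
import Data.Integer.Properties as ℤ
open import Data.List using (replicate)
open import Data.Maybe using (just; nothing)
open import Data.Nat as ℕ
  using (ℕ; zero; suc; _<_; _≤_; _∸_; _!; z≤n; s≤s; NonZero; NonTrivial; nonTrivial⇒n>1)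
import Data.Nat.Properties as ℕ
open import Data.Nat.Combinatorics using (_C_; nCn≡1; nCk≡nC[n∸k]; k![n∸k]!∣n!)
open import Data.Nat.Combinatorics.Specification using (nCk≡n!/k![n-k]!)
open import Data.Nat.Coprimality using (prime⇒coprime; coprime-Bézout)
open import Data.Nat.Divisibility using (_∣_; _∣?_; divides; ∣1⇒≡1; ∣⇒≤; m∣m*n; m%n≡0⇒n∣m)
open import Data.Nat.DivMod using (_%_; _/_; m/n*n≡m; m%n<n; m≡m%n+[m/n]*n)
import Data.Nat.GCD as GCD
open import Data.Nat.Induction using (<-rec)
open import Data.Nat.Primality using (Prime; prime⇒nonZero; prime⇒nonTrivial; euclidsLemma)
open import Data.Product using (∃; _×_; _,_; proj₁; proj₂)
import Data.Sign as Sign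
open import Data.Sum as Sum using (_⊎_; inj₁; inj₂)
open import Relation.Binary.Definitions using (WeaklyDecidable)
open import Relation.Binary.PropositionalEquality as ≡ using (_≡_; _≢_)
open import Relation.Nullary using (¬_; Dec; yes; no)
import Relation.Nullary.Decidable as Dec
open import Relation.Nullary.Decidable using (_×-dec_; decidable-stable)
import Relation.Unary as U

n∣n! : ∀ n → .{{NonZero n}} → n ∣ n !
n∣n! (suc n) = m∣m*n (n !)

module _ {p : ℕ} (prime : Prime p) where
  private instance
    p≢0 : NonZero p
    p≢0 = prime⇒nonZero prime
    p≢1 : NonTrivial p
    p≢1 = prime⇒nonTrivial prime

  prime∤! : ∀ {j} → j < p → ¬ (p ∣ j !)
  prime∤! {zero}  _   p∣1 = ℕ.<⇒≢ (nonTrivial⇒n>1 p) (≡.sym (∣1⇒≡1 p∣1))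
  prime∤! {suc j} j<p p∣[1+j]! with euclidsLemma (suc j) (j !) prime p∣[1+j]!
  ... | inj₁ p∣1+j = ℕ.<⇒≱ j<p (∣⇒≤ p∣1+j)
  ... | inj₂ p∣j!  = prime∤! (ℕ.<-trans (ℕ.n<1+n j) j<p) p∣j!

  prime∣C : ∀ {k} → 0 < k → k < p → p ∣ p C k
  prime∣C {k} 0<k k<p with euclidsLemma (p C k) (k ! ℕ.* (p ∸ k) !) prime p∣C*denominator
    where
    instance
      denominator≢0 : NonZero (k ! ℕ.* (p ∸ k) !)
      denominator≢0 = k ℕ.!* (p ∸ k) !≢0
    p∣C*denominator : p ∣ (p C k) ℕ.* (k ! ℕ.* (p ∸ k) !)
    p∣C*denominator = ≡.subst (p ∣_)
      (≡.sym (≡.trans (≡.cong (ℕ._* (k ! ℕ.* (p ∸ k) !)) (nCk≡n!/k![n-k]! (ℕ.<⇒≤ k<p)))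
                      (m/n*n≡m (k![n∸k]!∣n! (ℕ.<⇒≤ k<p)))))
      (n∣n! p)
  ... | inj₁ p∣C = p∣C
  ... | inj₂ p∣denominator with euclidsLemma (k !) ((p ∸ k) !) prime p∣denominator
  ...   | inj₁ p∣k!     = ⊥-elim (prime∤! k<p p∣k!)
  ...   | inj₂ p∣[p-k]! = ⊥-elim (prime∤! (ℕ.∸-monoʳ-< 0<k (ℕ.<⇒≤ k<p)) p∣[p-k]!)

module _ {a} {P : ℕ → Set a} (P? : U.Decidable P) where

  least-positive : ∀ N → 1 ≤ N → P N → ∃ λ m → 1 ≤ m × P m × (∀ k → 1 ≤ k → P k → m ≤ k)
  least-positive = <-rec _ search
    where
    Least : Set a
    Least = ∃ λ m → 1 ≤ m × P m × (∀ k → 1 ≤ k → P k → m ≤ k)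

    search : ∀ N → (∀ {M} → M < N → 1 ≤ M → P M → Least) → 1 ≤ N → P N → Least
    search N smaller 1≤N pN with ℕ.anyUpTo? (λ k → 1 ℕ.≤? k ×-dec P? k) N
    ... | yes (M , M<N , 1≤M , pM) = smaller M<N 1≤M pM
    ... | no ∄M = N , 1≤N , pN , λ k 1≤k pk → ℕ.≮⇒≥ (λ k<N → ∄M (k , k<N , 1≤k , pk))

module RingArithmetic {c ℓ : Level} (F : CommutativeRing c ℓ) where
  open CommutativeRing F
  open import Algebra.Properties.Ring ring
    using (-‿involutive; -0#≈0#; -‿distribˡ-*; -‿distribʳ-*; -‿+-comm; +-inverseʳ-unique)
  private
    module Exp = Algebra.Properties.CommutativeSemiring.Exp commutativeSemiring
    module Mult = Algebra.Properties.Semiring.Mult semiring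
    module ∑ = Algebra.Properties.Monoid.Sum +-monoid
    module Binomial = Algebra.Properties.CommutativeSemiring.Binomial commutativeSemiring
  open import Relation.Binary.Reasoning.Setoid setoid

  infixr 8 _^_
  _^_ : Carrier → ℕ → Carrier
  _^_ = pow F

  nat≈×1 : ∀ n → nat F n ≈ n Mult.× 1#
  nat≈×1 zero    = refl
  nat≈×1 (suc n) = +-congˡ (nat≈×1 n)

  nat-+ : ∀ m n → nat F (m ℕ.+ n) ≈ nat F m + nat F n
  nat-+ m n = trans (nat≈×1 (m ℕ.+ n))
    (trans (Mult.×-homo-+ 1# m n) (sym (+-cong (nat≈×1 m) (nat≈×1 n))))

  nat-* : ∀ m n → nat F (m ℕ.* n) ≈ nat F m * nat F n
  nat-* m n = trans (nat≈×1 (m ℕ.* n))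
    (trans (Mult.×1-homo-* m n) (sym (*-cong (nat≈×1 m) (nat≈×1 n))))

  pow≈Exp^ : ∀ x n → x ^ n ≈ x Exp.^ n
  pow≈Exp^ x zero    = refl
  pow≈Exp^ x (suc n) = *-congˡ (pow≈Exp^ x n)

  ^-cong : ∀ n {x y} → x ≈ y → x ^ n ≈ y ^ n
  ^-cong n {x} {y} x≈y = trans (pow≈Exp^ x n) (trans (Exp.^-congˡ n x≈y) (sym (pow≈Exp^ y n)))

  ^-* : ∀ x m n → x ^ (m ℕ.* n) ≈ (x ^ m) ^ n
  ^-* x m n = trans (pow≈Exp^ x (m ℕ.* n)) (trans (sym (Exp.^-assocʳ x m n))
    (sym (trans (pow≈Exp^ (x ^ m) n) (Exp.^-congˡ n (pow≈Exp^ x m)))))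

  ^-distrib-* : ∀ x y n → (x * y) ^ n ≈ x ^ n * y ^ n
  ^-distrib-* x y n = trans (pow≈Exp^ (x * y) n)
    (trans (Exp.^-distrib-* x y n) (sym (*-cong (pow≈Exp^ x n) (pow≈Exp^ y n))))

  1^n≈1 : ∀ n → 1# ^ n ≈ 1#
  1^n≈1 zero    = refl
  1^n≈1 (suc n) = trans (*-identityˡ _) (1^n≈1 n)

  0^n≈0 : ∀ {n} → 0 < n → 0# ^ n ≈ 0#
  0^n≈0 {suc n} _ = zeroˡ _

  nat-^ : ∀ m n → nat F (m ℕ.^ n) ≈ nat F m ^ n
  nat-^ m zero    = +-identityʳ 1#
  nat-^ m (suc n) = trans (nat-* m (m ℕ.^ n)) (*-congˡ (nat-^ m n))

  -- The solver reads `con (+ n)` as ⟦ + n ⟧ℤ; sending + 1 to 1# itself, and every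
  -- other + n to nat F n, lets it match the literals 1#, nat F 2, nat F 4 definitionally.
  ⟦_⟧ℤ : ℤ → Carrier
  ⟦ + 1 ⟧ℤ      = 1#
  ⟦ -[1+ 0 ] ⟧ℤ = - 1#
  ⟦ + n ⟧ℤ      = nat F n
  ⟦ -[1+ n ] ⟧ℤ = - nat F (suc n)

  ⟦_⟧ⁿ : ℤ → Carrier
  ⟦ + n ⟧ⁿ      = nat F n
  ⟦ -[1+ n ] ⟧ⁿ = - nat F (suc n)

  private
    suc-sub-suc : ∀ a b → (1# + a) - (1# + b) ≈ a - b
    suc-sub-suc a b = begin
      (1# + a) - (1# + b)      ≈⟨ +-congˡ (sym (-‿+-comm 1# b)) ⟩
      (1# + a) + (- 1# - b)    ≈⟨ +-assoc 1# a _ ⟩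
      1# + (a + (- 1# - b))    ≈⟨ +-congˡ (+-congˡ (+-comm (- 1#) (- b))) ⟩
      1# + (a + (- b - 1#))    ≈⟨ +-congˡ (sym (+-assoc a (- b) (- 1#))) ⟩
      1# + ((a - b) - 1#)      ≈⟨ +-comm 1# _ ⟩
      ((a - b) - 1#) + 1#      ≈⟨ +-assoc _ _ _ ⟩
      (a - b) + (- 1# + 1#)    ≈⟨ +-congˡ (-‿inverseˡ 1#) ⟩
      (a - b) + 0#             ≈⟨ +-identityʳ _ ⟩
      a - b                    ∎

    x≈x-0 : ∀ x → x ≈ x - 0#
    x≈x-0 x = sym (trans (+-congˡ -0#≈0#) (+-identityʳ x))

  ⟦⊖⟧ : ∀ m n → ⟦ m ℤ.⊖ n ⟧ⁿ ≈ nat F m - nat F n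
  ⟦⊖⟧ zero    zero    = x≈x-0 0#
  ⟦⊖⟧ zero    (suc n) = sym (+-identityˡ _)
  ⟦⊖⟧ (suc m) zero    = x≈x-0 _
  ⟦⊖⟧ (suc m) (suc n) = begin
    ⟦ suc m ℤ.⊖ suc n ⟧ⁿ  ≡⟨ ≡.cong ⟦_⟧ⁿ (ℤ.[1+m]⊖[1+n]≡m⊖n m n) ⟩
    ⟦ m ℤ.⊖ n ⟧ⁿ          ≈⟨ ⟦⊖⟧ m n ⟩
    nat F m - nat F n     ≈⟨ sym (suc-sub-suc _ _) ⟩
    nat F (suc m) - nat F (suc n) ∎

  ⟦-⟧ : ∀ i → ⟦ ℤ.- i ⟧ⁿ ≈ - ⟦ i ⟧ⁿ
  ⟦-⟧ (+ zero)  = sym -0#≈0#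
  ⟦-⟧ (+ suc n) = refl
  ⟦-⟧ -[1+ n ]  = sym (-‿involutive _)

  ⟦+⟧ : ∀ i j → ⟦ i ℤ.+ j ⟧ⁿ ≈ ⟦ i ⟧ⁿ + ⟦ j ⟧ⁿ
  ⟦+⟧ (+ m)    (+ n)    = nat-+ m n
  ⟦+⟧ (+ m)    -[1+ n ] = ⟦⊖⟧ m (suc n)
  ⟦+⟧ -[1+ m ] (+ n)    = trans (⟦⊖⟧ n (suc m)) (+-comm _ _)
  ⟦+⟧ -[1+ m ] -[1+ n ] = begin
    - nat F (suc (suc (m ℕ.+ n)))      ≡⟨ ≡.cong (λ k → - nat F (suc k)) (ℕ.+-suc m n) ⟨
    - nat F (suc m ℕ.+ suc n)          ≈⟨ -‿cong (nat-+ (suc m) (suc n)) ⟩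
    - (nat F (suc m) + nat F (suc n))  ≈⟨ -‿+-comm _ _ ⟨
    - nat F (suc m) - nat F (suc n)    ∎

  ⟦+◃⟧ : ∀ n → ⟦ Sign.+ ℤ.◃ n ⟧ⁿ ≈ nat F n
  ⟦+◃⟧ zero    = refl
  ⟦+◃⟧ (suc n) = refl

  ⟦-◃⟧ : ∀ n → ⟦ Sign.- ℤ.◃ n ⟧ⁿ ≈ - nat F n
  ⟦-◃⟧ zero    = sym -0#≈0#
  ⟦-◃⟧ (suc n) = refl

  ⟦*⟧ : ∀ i j → ⟦ i ℤ.* j ⟧ⁿ ≈ ⟦ i ⟧ⁿ * ⟦ j ⟧ⁿ
  ⟦*⟧ (+ m)    (+ n)    = trans (⟦+◃⟧ (m ℕ.* n)) (nat-* m n)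
  ⟦*⟧ (+ m)    -[1+ n ] = trans (⟦-◃⟧ (m ℕ.* suc n)) (trans (-‿cong (nat-* m (suc n))) (-‿distribʳ-* _ _))
  ⟦*⟧ -[1+ m ] (+ n)    = trans (⟦-◃⟧ (suc m ℕ.* n)) (trans (-‿cong (nat-* (suc m) n)) (-‿distribˡ-* _ _))
  ⟦*⟧ -[1+ m ] -[1+ n ] = trans (⟦+◃⟧ (suc m ℕ.* suc n)) (trans (nat-* (suc m) (suc n)) (sym (-x*-y≈x*y _ _)))
    where
    -x*-y≈x*y : ∀ x y → - x * - y ≈ x * y
    -x*-y≈x*y x y = trans (sym (-‿distribˡ-* x (- y))) (trans (-‿cong (sym (-‿distribʳ-* x y))) (-‿involutive _))


  ⟦⟧ℤ≈⟦⟧ⁿ : ∀ i → ⟦ i ⟧ℤ ≈ ⟦ i ⟧ⁿ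
  ⟦⟧ℤ≈⟦⟧ⁿ (+ zero)          = refl
  ⟦⟧ℤ≈⟦⟧ⁿ (+ 1)             = sym (+-identityʳ 1#)
  ⟦⟧ℤ≈⟦⟧ⁿ (+ suc (suc n))   = refl
  ⟦⟧ℤ≈⟦⟧ⁿ -[1+ zero ]       = -‿cong (sym (+-identityʳ 1#))
  ⟦⟧ℤ≈⟦⟧ⁿ -[1+ suc n ]      = refl

  ℤ-morphism : ℤ.+-*-rawRing ACR.-Raw-AlmostCommutative⟶ ACR.fromCommutativeRing F
  ℤ-morphism = record
    { ⟦_⟧    = ⟦_⟧ℤ
    ; +-homo = λ i j → trans (⟦⟧ℤ≈⟦⟧ⁿ (i ℤ.+ j))
                             (trans (⟦+⟧ i j) (sym (+-cong (⟦⟧ℤ≈⟦⟧ⁿ i) (⟦⟧ℤ≈⟦⟧ⁿ j))))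
    ; *-homo = λ i j → trans (⟦⟧ℤ≈⟦⟧ⁿ (i ℤ.* j))
                             (trans (⟦*⟧ i j) (sym (*-cong (⟦⟧ℤ≈⟦⟧ⁿ i) (⟦⟧ℤ≈⟦⟧ⁿ j))))
    ; -‿homo = λ i → trans (⟦⟧ℤ≈⟦⟧ⁿ (ℤ.- i)) (trans (⟦-⟧ i) (-‿cong (sym (⟦⟧ℤ≈⟦⟧ⁿ i))))
    ; 0-homo = refl
    ; 1-homo = refl
    }

  _≟ℤ_ : WeaklyDecidable (ACR.Induced-equivalence ℤ-morphism)
  i ≟ℤ j with i ℤ.≟ j
  ... | yes ≡.refl = just refl
  ... | no _       = nothing

  open import Algebra.Solver.Ring ℤ.+-*-rawRing (ACR.fromCommutativeRing F) ℤ-morphism _≟ℤ_ public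
    using (solve; _:=_; con; _:+_; _:*_; _:-_; :-_; _:^_)

  ×≈nat* : ∀ n x → n Mult.× x ≈ nat F n * x
  ×≈nat* zero    x = sym (zeroˡ x)
  ×≈nat* (suc n) x = trans (+-cong (sym (*-identityˡ x)) (×≈nat* n x)) (sym (distribʳ x 1# (nat F n)))

  freshmans-dream : ∀ {n} → 1 < n → (∀ k → 0 < k → k < n → nat F (n C k) ≈ 0#) →
                    ∀ a b → (a + b) ^ n ≈ a ^ n + b ^ n
  freshmans-dream (s≤s (s≤s {n = m} _)) inner≈0 a b = begin
    (a + b) ^ n                                     ≈⟨ pow≈Exp^ (a + b) n ⟩
    (a + b) Exp.^ n                                 ≈⟨ Binomial.theorem n a b ⟩
    t Fin.zero + ∑.sum (λ i → t (Fin.suc i))      ≈⟨ +-congˡ (∑.sum-init-last (λ i → t (Fin.suc i))) ⟩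
    t Fin.zero + (∑.sum inner + t (fromℕ n))      ≈⟨ +-congˡ (+-congʳ inner-sum≈0) ⟩
    t Fin.zero + (0# + t (fromℕ n))                 ≈⟨ +-cong (first n) (trans (+-identityˡ _) (last n)) ⟩
    b ^ n + a ^ n                                   ≈⟨ +-comm _ _ ⟩
    a ^ n + b ^ n                                   ∎
    where
    n : ℕ
    n = suc (suc m)

    t : Fin (suc n) → Carrier
    t = Binomial.binomialTerm a b n

    inner : Fin (suc m) → Carrier
    inner i = t (Fin.suc (inject₁ i))

    inner-sum≈0 : ∑.sum inner ≈ 0#
    inner-sum≈0 = trans (∑.sum-cong-≋ inner≈0′) (∑.sum-replicate-zero (suc m))
      where
      inner≈0′ : ∀ i → inner i ≈ 0#
      inner≈0′ i = trans (×≈nat* (n C k) _) (trans (*-congʳ (inner≈0 k (s≤s z≤n) k<n)) (zeroˡ _))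
        where
        k : ℕ
        k = suc (toℕ (inject₁ i))

        k<n : k < n
        k<n = s≤s (≡.subst (_< suc m) (≡.sym (Fin.toℕ-inject₁ i)) (Fin.toℕ<n i))

    first : ∀ j → Binomial.binomialTerm a b j Fin.zero ≈ b ^ j
    first j rewrite nCk≡nC[n∸k] {0} {j} z≤n | nCn≡1 j =
      trans (+-identityʳ _) (trans (*-identityˡ _) (sym (pow≈Exp^ b j)))

    last : ∀ j → Binomial.binomialTerm a b j (fromℕ j) ≈ a ^ j
    last j rewrite Fin.toℕ-fromℕ j | nCn≡1 j | ℕ.n∸n≡0 j =
      trans (+-identityʳ _) (trans (*-identityʳ _) (sym (pow≈Exp^ a j)))

  evalMonic-zeros : ∀ n t → evalMonic F (replicate n 0#) t ≈ t ^ n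
  evalMonic-zeros zero    t = refl
  evalMonic-zeros (suc n) t = trans (+-identityˡ _) (*-congˡ (evalMonic-zeros n t))

  algClosed⇒root : IsAlgClosed F → ∀ a n → ∃ λ t → t ^ suc n ≈ a
  algClosed⇒root algClosed a n with algClosed (- a) (replicate n 0#)
  ... | t , -a+tⁿ⁺¹≈0 = t , (begin
    t ^ suc n                                    ≈⟨ *-congˡ (evalMonic-zeros n t) ⟨
    t * evalMonic F (replicate n 0#) t           ≈⟨ +-inverseʳ-unique (- a) _ -a+tⁿ⁺¹≈0 ⟩
    - - a                                        ≈⟨ -‿involutive a ⟩
    a                                            ∎)

module FieldArithmetic {c ℓ : Level} (F : CommutativeRing c ℓ) (isField : IsField F) where
  open CommutativeRing F
  open RingArithmetic F public
  open import Relation.Binary.Reasoning.Setoid setoid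

  1≉0 : 1# ≉ 0#
  1≉0 = proj₁ isField

  *-cancelʳ : ∀ {a b c} → c ≉ 0# → a * c ≈ b * c → a ≈ b
  *-cancelʳ {a} {b} {c} c≉0 ac≈bc with proj₂ isField c c≉0
  ... | c⁻¹ , cc⁻¹≈1 = begin
    a              ≈⟨ trans (*-congˡ cc⁻¹≈1) (*-identityʳ a) ⟨
    a * (c * c⁻¹)  ≈⟨ *-assoc a c c⁻¹ ⟨
    a * c * c⁻¹    ≈⟨ *-congʳ ac≈bc ⟩
    b * c * c⁻¹    ≈⟨ *-assoc b c c⁻¹ ⟩
    b * (c * c⁻¹)  ≈⟨ trans (*-congˡ cc⁻¹≈1) (*-identityʳ b) ⟩
    b              ∎

  *-cancelˡ : ∀ {a b c} → c ≉ 0# → c * a ≈ c * b → a ≈ b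
  *-cancelˡ c≉0 ca≈cb = *-cancelʳ c≉0 (trans (*-comm _ _) (trans ca≈cb (*-comm _ _)))

  *≈0⇒≈0 : ∀ {a c} → c ≉ 0# → a * c ≈ 0# → a ≈ 0#
  *≈0⇒≈0 c≉0 ac≈0 = *-cancelʳ c≉0 (trans ac≈0 (sym (zeroˡ _)))

  *-≉0 : ∀ {a b} → a ≉ 0# → b ≉ 0# → a * b ≉ 0#
  *-≉0 a≉0 b≉0 ab≈0 = a≉0 (*≈0⇒≈0 b≉0 ab≈0)

  ^-≉0 : ∀ {x} n → x ≉ 0# → x ^ n ≉ 0#
  ^-≉0 zero    x≉0 = 1≉0
  ^-≉0 (suc n) x≉0 = *-≉0 x≉0 (^-≉0 n x≉0)

  quadratic-formula : ∀ {z s r} → nat F 2 ≉ 0# → s * s ≈ z * z + nat F 4 * z →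
                      nat F 2 * r ≈ - (z + nat F 2) + s ⊎ nat F 2 * r ≈ - (z + nat F 2) - s →
                      r * r + (z + nat F 2) * r + 1# ≈ 0#
  quadratic-formula {z} {s} {r} 2≉0 s²≈z²+4z 2r≈ = *≈0⇒≈0 (*-≉0 2≉0 2≉0) (begin
    (r * r + (z + nat F 2) * r + 1#) * (nat F 2 * nat F 2)
      ≈⟨ solve 2 (λ r z → (r :* r :+ (z :+ con (+ 2)) :* r :+ con (+ 1)) :* (con (+ 2) :* con (+ 2))
                          := (con (+ 2) :* r :+ (z :+ con (+ 2))) :* (con (+ 2) :* r :+ (z :+ con (+ 2)))
                             :- (z :* z :+ con (+ 4) :* z))
           refl r z ⟩
    u * u - (z * z + nat F 4 * z)  ≈⟨ +-cong u²≈s² (-‿cong (sym s²≈z²+4z)) ⟩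
    s * s - s * s                  ≈⟨ -‿inverseʳ _ ⟩
    0#                             ∎)
    where
    u : Carrier
    u = nat F 2 * r + (z + nat F 2)

    u≈±s : u ≈ s ⊎ u ≈ - s
    u≈±s = Sum.map
      (λ 2r≈-[z+2]+s → trans (+-congʳ 2r≈-[z+2]+s)
                             (solve 2 (λ z s → (:- (z :+ con (+ 2)) :+ s) :+ (z :+ con (+ 2)) := s) refl z s))
      (λ 2r≈-[z+2]-s → trans (+-congʳ 2r≈-[z+2]-s)
                             (solve 2 (λ z s → (:- (z :+ con (+ 2)) :- s) :+ (z :+ con (+ 2)) := :- s) refl z s))
      2r≈

    u²≈s² : u * u ≈ s * s
    u²≈s² = Sum.[ (λ u≈s → *-cong u≈s u≈s)
                , (λ u≈-s → trans (*-cong u≈-s u≈-s) (solve 1 (λ s → (:- s) :* (:- s) := s :* s) refl s)) ]′ u≈±s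

module PrimeCharacteristic {c ℓ : Level} (F : CommutativeRing c ℓ) {p : ℕ} (prime : Prime p)
                           (isField : IsField F) (char : HasChar F p) where
  open CommutativeRing F
  open FieldArithmetic F isField public
  open import Algebra.Properties.Ring ring
    using (-‿distribʳ-*; +-inverseʳ-unique; +-inverseˡ-unique; x∙y⁻¹≈ε⇒x≈y; x≈y⇒x∙y⁻¹≈ε)
  open import Relation.Binary.Reasoning.Setoid setoid

  private instance
    p≢0 : NonZero p
    p≢0 = prime⇒nonZero prime
    p≢1 : NonTrivial p
    p≢1 = prime⇒nonTrivial prime

  p-1>0 : 0 < ℕ.pred p
  p-1>0 = ℕ.pred-mono-≤ (nonTrivial⇒n>1 p)

  nat≈0⇐p∣ : ∀ {n} → p ∣ n → nat F n ≈ 0#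
  nat≈0⇐p∣ (divides q ≡.refl) = trans (nat-* q p) (trans (*-congˡ char) (zeroʳ _))

  nat≉0 : ∀ {j} → 0 < j → j < p → nat F j ≉ 0#
  nat≉0 {suc j} _ j<p j≈0 with coprime-Bézout (prime⇒coprime prime j<p)
  ... | GCD.Bézout.+- x y 1+yj≡xp = 1≉0 (begin
    1#                        ≈⟨ +-identityʳ 1# ⟨
    1# + 0#                   ≈⟨ +-congˡ (trans (*-congˡ j≈0) (zeroʳ _)) ⟨
    1# + nat F y * nat F (suc j) ≈⟨ +-congˡ (nat-* y (suc j)) ⟨
    nat F (1 ℕ.+ y ℕ.* suc j) ≡⟨ ≡.cong (nat F) 1+yj≡xp ⟩
    nat F (x ℕ.* p)           ≈⟨ nat≈0⇐p∣ (divides x ≡.refl) ⟩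
    0#                        ∎)
  ... | GCD.Bézout.-+ x y 1+xp≡yj = 1≉0 (begin
    1#                        ≈⟨ +-identityʳ 1# ⟨
    1# + 0#                   ≈⟨ +-congˡ (nat≈0⇐p∣ (divides x ≡.refl)) ⟨
    nat F (1 ℕ.+ x ℕ.* p)     ≡⟨ ≡.cong (nat F) 1+xp≡yj ⟩
    nat F (y ℕ.* suc j)       ≈⟨ nat-* y (suc j) ⟩
    nat F y * nat F (suc j)   ≈⟨ trans (*-congˡ j≈0) (zeroʳ _) ⟩
    0#                        ∎)

  nat2≉0 : p ≢ 2 → nat F 2 ≉ 0#
  nat2≉0 p≢2 = nat≉0 (s≤s z≤n) (ℕ.≤∧≢⇒< (nonTrivial⇒n>1 p) (λ 2≡p → p≢2 (≡.sym 2≡p)))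

  nat≈0⇒p∣ : ∀ n → nat F n ≈ 0# → p ∣ n
  nat≈0⇒p∣ n n≈0 with n % p in n%p≡ | m%n<n n p
  ... | zero  | _ = m%n≡0⇒n∣m n p n%p≡
  ... | suc j | j<p = ⊥-elim (nat≉0 (s≤s z≤n) j<p (begin
    nat F (suc j)                         ≡⟨ ≡.cong (nat F) n%p≡ ⟨
    nat F (n % p)                         ≈⟨ +-identityʳ _ ⟨
    nat F (n % p) + 0#                    ≈⟨ +-congˡ (nat≈0⇐p∣ (divides (n / p) ≡.refl)) ⟨
    nat F (n % p) + nat F (n / p ℕ.* p)   ≈⟨ nat-+ (n % p) _ ⟨
    nat F (n % p ℕ.+ n / p ℕ.* p)         ≡⟨ ≡.cong (nat F) (m≡m%n+[m/n]*n n p) ⟨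
    nat F n                               ≈⟨ n≈0 ⟩
    0#                                    ∎))

  nat≈0? : ∀ n → Dec (nat F n ≈ 0#)
  nat≈0? n = Dec.map′ nat≈0⇐p∣ (nat≈0⇒p∣ n) (p ∣? n)

  nat[p-1]≈-1 : nat F (ℕ.pred p) ≈ - 1#
  nat[p-1]≈-1 = +-inverseʳ-unique 1# _ (trans (reflexive (≡.cong (nat F) (ℕ.suc-pred p))) char)

  nat≈1? : ∀ n → Dec (nat F n ≈ 1#)
  nat≈1? n = Dec.map′ (λ p∣ → x∙y⁻¹≈ε⇒x≈y _ _ (trans (sym nat[n+p-1]) (nat≈0⇐p∣ p∣)))
                      (λ n≈1 → nat≈0⇒p∣ _ (trans nat[n+p-1] (x≈y⇒x∙y⁻¹≈ε n≈1)))
                      (p ∣? n ℕ.+ ℕ.pred p)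
    where
    nat[n+p-1] : nat F (n ℕ.+ ℕ.pred p) ≈ nat F n - 1#
    nat[n+p-1] = trans (nat-+ n (ℕ.pred p)) (+-congˡ nat[p-1]≈-1)

  frobenius-+ : ∀ a b → (a + b) ^ p ≈ a ^ p + b ^ p
  frobenius-+ = freshmans-dream (nonTrivial⇒n>1 p) (λ _ 0<k k<p → nat≈0⇐p∣ (prime∣C prime 0<k k<p))

  frobenius-‿ : ∀ a → (- a) ^ p ≈ - (a ^ p)
  frobenius-‿ a = +-inverseˡ-unique _ _ (begin
    (- a) ^ p + a ^ p  ≈⟨ frobenius-+ (- a) a ⟨
    (- a + a) ^ p      ≈⟨ ^-cong p (-‿inverseˡ a) ⟩
    0# ^ p             ≈⟨ 0^n≈0 (ℕ.>-nonZero⁻¹ p) ⟩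
    0#                 ∎)

  frobenius-nat : ∀ n → nat F n ^ p ≈ nat F n
  frobenius-nat zero    = 0^n≈0 (ℕ.>-nonZero⁻¹ p)
  frobenius-nat (suc n) = trans (frobenius-+ 1# (nat F n)) (+-cong (1^n≈1 p) (frobenius-nat n))

  φ : ℕ → Carrier → Carrier
  φ i x = x ^ (p ℕ.^ i)

  φ-cong : ∀ i {x y} → x ≈ y → φ i x ≈ φ i y
  φ-cong i = ^-cong (p ℕ.^ i)

  φ-zero : ∀ x → φ 0 x ≈ x
  φ-zero = *-identityʳ

  φ-suc : ∀ i x → φ (suc i) x ≈ φ i (x ^ p)
  φ-suc i x = ^-* x p (p ℕ.^ i)

  φ-φ : ∀ i j x → φ i (φ j x) ≈ φ (j ℕ.+ i) x
  φ-φ i j x = sym (trans (reflexive (≡.cong (x ^_) (ℕ.^-distribˡ-+-* p j i))) (^-* x (p ℕ.^ j) (p ℕ.^ i)))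

  φ-comm : ∀ i j x → φ i (φ j x) ≈ φ j (φ i x)
  φ-comm i j x = trans (φ-φ i j x) (trans (reflexive (≡.cong (λ n → φ n x) (ℕ.+-comm j i))) (sym (φ-φ j i x)))

  φ-+ : ∀ i a b → φ i (a + b) ≈ φ i a + φ i b
  φ-+ zero    a b = trans (φ-zero _) (sym (+-cong (φ-zero a) (φ-zero b)))
  φ-+ (suc i) a b = begin
    φ (suc i) (a + b)            ≈⟨ φ-suc i (a + b) ⟩
    φ i ((a + b) ^ p)            ≈⟨ φ-cong i (frobenius-+ a b) ⟩
    φ i (a ^ p + b ^ p)          ≈⟨ φ-+ i (a ^ p) (b ^ p) ⟩
    φ i (a ^ p) + φ i (b ^ p)    ≈⟨ +-cong (φ-suc i a) (φ-suc i b) ⟨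
    φ (suc i) a + φ (suc i) b    ∎

  φ-‿ : ∀ i a → φ i (- a) ≈ - φ i a
  φ-‿ zero    a = trans (φ-zero _) (-‿cong (sym (φ-zero a)))
  φ-‿ (suc i) a = begin
    φ (suc i) (- a)    ≈⟨ φ-suc i (- a) ⟩
    φ i ((- a) ^ p)    ≈⟨ φ-cong i (frobenius-‿ a) ⟩
    φ i (- (a ^ p))    ≈⟨ φ-‿ i (a ^ p) ⟩
    - φ i (a ^ p)      ≈⟨ -‿cong (φ-suc i a) ⟨
    - φ (suc i) a      ∎

  φ-- : ∀ i a b → φ i (a - b) ≈ φ i a - φ i b
  φ-- i a b = trans (φ-+ i a (- b)) (+-congˡ (φ-‿ i b))

  φ-* : ∀ i a b → φ i (a * b) ≈ φ i a * φ i b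
  φ-* i a b = ^-distrib-* a b (p ℕ.^ i)

  φ-nat : ∀ i n → φ i (nat F n) ≈ nat F n
  φ-nat zero    n = φ-zero _
  φ-nat (suc i) n = trans (φ-suc i _) (trans (φ-cong i (frobenius-nat n)) (φ-nat i n))

  φ-1 : ∀ i → φ i 1# ≈ 1#
  φ-1 i = 1^n≈1 (p ℕ.^ i)

  φ-≉0 : ∀ i {x} → x ≉ 0# → φ i x ≉ 0#
  φ-≉0 i = ^-≉0 (p ℕ.^ i)

  InPrimeField : Carrier → Set ℓ
  InPrimeField x = ∃ λ n → x ≈ nat F n

  InFp⇒InPrimeField : ∀ {x} → InFp F p x → InPrimeField x
  InFp⇒InPrimeField (n , _ , x≈n) = n , x≈n

  InPrimeField-resp : ∀ {x y} → x ≈ y → InPrimeField x → InPrimeField y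
  InPrimeField-resp x≈y (n , x≈n) = n , trans (sym x≈y) x≈n

  InPrimeField-nat : ∀ n → InPrimeField (nat F n)
  InPrimeField-nat n = n , refl

  InPrimeField-+ : ∀ {a b} → InPrimeField a → InPrimeField b → InPrimeField (a + b)
  InPrimeField-+ (m , a≈m) (n , b≈n) = m ℕ.+ n , trans (+-cong a≈m b≈n) (sym (nat-+ m n))

  InPrimeField-* : ∀ {a b} → InPrimeField a → InPrimeField b → InPrimeField (a * b)
  InPrimeField-* (m , a≈m) (n , b≈n) = m ℕ.* n , trans (*-cong a≈m b≈n) (sym (nat-* m n))

  InPrimeField-^ : ∀ {a} k → InPrimeField a → InPrimeField (a ^ k)
  InPrimeField-^ k (m , a≈m) = m ℕ.^ k , trans (^-cong k a≈m) (sym (nat-^ m k))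

  InPrimeField-‿ : ∀ {a} → InPrimeField a → InPrimeField (- a)
  InPrimeField-‿ {a} (n , a≈n) = n ℕ.* ℕ.pred p , (begin
    - a                          ≈⟨ -‿cong (trans a≈n (sym (*-identityʳ _))) ⟩
    - (nat F n * 1#)             ≈⟨ -‿distribʳ-* (nat F n) 1# ⟩
    nat F n * - 1#               ≈⟨ *-congˡ nat[p-1]≈-1 ⟨
    nat F n * nat F (ℕ.pred p)   ≈⟨ nat-* n (ℕ.pred p) ⟨
    nat F (n ℕ.* ℕ.pred p)       ∎)

  InPrimeField-frobenius : ∀ {x} → InPrimeField x → x ^ p ≈ x
  InPrimeField-frobenius (n , x≈n) = trans (^-cong p x≈n) (trans (frobenius-nat n) (sym x≈n))

  InPrimeField-φ : ∀ {x} → InPrimeField x → ∀ i → φ i x ≈ x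
  InPrimeField-φ (n , x≈n) i = trans (φ-cong i x≈n) (trans (φ-nat i n) (sym x≈n))

  fermat : ∀ {x} → InPrimeField x → x ≉ 0# → x ^ ℕ.pred p ≈ 1#
  fermat {x} x∈Fp x≉0 = *-cancelˡ x≉0 (begin
    x * x ^ ℕ.pred p  ≡⟨ ≡.cong (x ^_) (ℕ.suc-pred p) ⟩
    x ^ p             ≈⟨ InPrimeField-frobenius x∈Fp ⟩
    x                 ≈⟨ *-identityʳ x ⟨
    x * 1#            ∎)

  InPrimeField-÷ : ∀ {a b x} → InPrimeField a → InPrimeField b → b ≉ 0# → b * x ≈ a → InPrimeField x
  InPrimeField-÷ {a} {b} {x} a∈Fp b∈Fp b≉0 bx≈a =
    InPrimeField-resp ab′≈x (InPrimeField-* a∈Fp (InPrimeField-^ (p ∸ 2) b∈Fp))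
    where
    b′ : Carrier
    b′ = b ^ (p ∸ 2)

    bb′≈1 : b * b′ ≈ 1#
    bb′≈1 = trans (reflexive (≡.cong (b ^_) (≡.sym (ℕ.+-∸-assoc 1 (nonTrivial⇒n>1 p))))) (fermat b∈Fp b≉0)

    ab′≈x : a * b′ ≈ x
    ab′≈x = begin
      a * b′        ≈⟨ *-congʳ bx≈a ⟨
      b * x * b′    ≈⟨ solve 3 (λ b x b′ → b :* x :* b′ := x :* (b :* b′)) refl b x b′ ⟩
      x * (b * b′)  ≈⟨ trans (*-congˡ bb′≈1) (*-identityʳ x) ⟩
      x             ∎

  ^≈1? : ∀ {x} → InPrimeField x → ∀ k → Dec (x ^ k ≈ 1#)
  ^≈1? (n , x≈n) k = Dec.map′ (trans (trans (^-cong k x≈n) (sym (nat-^ n k))))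
                              (trans (trans (nat-^ n k) (^-cong k (sym x≈n))))
                              (nat≈1? (n ℕ.^ k))

  linIndep⇒≉0 : ∀ {x y} → LinIndep F p x y → x ≉ 0#
  linIndep⇒≉0 {x} {y} linIndep x≈0 = 1≉0 (trans (sym (+-identityʳ 1#)) (proj₁ (linIndep 1 0 1x+0y≈0)))
    where
    1x+0y≈0 : nat F 1 * x + nat F 0 * y ≈ 0#
    1x+0y≈0 = trans (+-cong (trans (*-congˡ x≈0) (zeroʳ _)) (zeroˡ y)) (+-identityʳ 0#)

  linIndep-1 : ∀ {t} → t ^ p ≉ t → LinIndep F p 1# t
  linIndep-1 {t} t^p≉t a b a+bt≈0 with nat≈0? b
  ... | yes b≈0 = a≈0 , b≈0
    where
    a≈0 : nat F a ≈ 0#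
    a≈0 = begin
      nat F a                     ≈⟨ *-identityʳ _ ⟨
      nat F a * 1#                ≈⟨ +-identityʳ _ ⟨
      nat F a * 1# + 0#           ≈⟨ +-congˡ (trans (*-congʳ b≈0) (zeroˡ t)) ⟨
      nat F a * 1# + nat F b * t  ≈⟨ a+bt≈0 ⟩
      0#                          ∎
  ... | no b≉0 = ⊥-elim (t^p≉t (InPrimeField-frobenius t∈Fp))
    where
    t∈Fp : InPrimeField t
    t∈Fp = InPrimeField-÷ (InPrimeField-‿ (InPrimeField-resp (sym (*-identityʳ _)) (InPrimeField-nat a)))
                          (InPrimeField-nat b) b≉0 (+-inverseʳ-unique _ _ a+bt≈0)

module OrderOfAppearance {c ℓ : Level} (F : CommutativeRing c ℓ) {p : ℕ} (prime : Prime p)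
                         (isField : IsField F) (char : HasChar F p) where
  open CommutativeRing F
  open PrimeCharacteristic F prime isField char public
  open import Algebra.Properties.Ring ring using (+-inverseˡ-unique; x∙y⁻¹≈ε⇒x≈y; -‿distribˡ-*)
  open import Relation.Binary.Reasoning.Setoid setoid

  private instance
    p≢0 : NonZero p
    p≢0 = prime⇒nonZero prime

  module Root (z r : Carrier) (z∈Fp : InPrimeField z) (r∈Fp : InPrimeField r)
              (quad : r * r + (z + nat F 2) * r + 1# ≈ 0#) where

    r≉0 : r ≉ 0#
    r≉0 r≈0 = 1≉0 (begin
      1#
        ≈⟨ solve 1 (λ z → con (+ 1) := con (+ 0) :* con (+ 0) :+ (z :+ con (+ 2)) :* con (+ 0) :+ con (+ 1)) refl z ⟩
      0# * 0# + (z + nat F 2) * 0# + 1#  ≈⟨ +-congʳ (+-cong (*-cong r≈0 r≈0) (*-congˡ r≈0)) ⟨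
      r * r + (z + nat F 2) * r + 1#     ≈⟨ quad ⟩
      0#                                 ∎)

    r≉1 : z ≉ - nat F 4 → r ≉ 1#
    r≉1 z≉-4 r≈1 = z≉-4 (+-inverseˡ-unique z (nat F 4) (begin
      z + nat F 4
        ≈⟨ solve 1 (λ z → z :+ con (+ 4) := con (+ 1) :* con (+ 1) :+ (z :+ con (+ 2)) :* con (+ 1) :+ con (+ 1)) refl z ⟩
      1# * 1# + (z + nat F 2) * 1# + 1#        ≈⟨ +-congʳ (+-cong (*-cong r≈1 r≈1) (*-congˡ r≈1)) ⟨
      r * r + (z + nat F 2) * r + 1#           ≈⟨ quad ⟩
      0#                                       ∎))

    module _ (r≉1 : r ≉ 1#) {t : Carrier} (tᵖ⁻¹≈r : t ^ ℕ.pred p ≈ r) where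

      tᵖ≈rt : t ^ p ≈ r * t
      tᵖ≈rt = begin
        t ^ p             ≡⟨ ≡.cong (t ^_) (ℕ.suc-pred p) ⟨
        t * t ^ ℕ.pred p  ≈⟨ *-congˡ tᵖ⁻¹≈r ⟩
        t * r             ≈⟨ *-comm t r ⟩
        r * t             ∎

      t≉0 : t ≉ 0#
      t≉0 t≈0 = r≉0 (trans (sym tᵖ⁻¹≈r) (trans (^-cong (ℕ.pred p) t≈0) (0^n≈0 p-1>0)))

      φ-t : ∀ i → φ i t ≈ r ^ i * t
      φ-t zero    = trans (φ-zero t) (sym (*-identityˡ t))
      φ-t (suc i) = begin
        φ (suc i) t      ≈⟨ φ-suc i t ⟩
        φ i (t ^ p)      ≈⟨ φ-cong i tᵖ≈rt ⟩
        φ i (r * t)      ≈⟨ φ-* i r t ⟩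
        φ i r * φ i t    ≈⟨ *-cong (InPrimeField-φ r∈Fp i) (φ-t i) ⟩
        r * (r ^ i * t)  ≈⟨ *-assoc r _ t ⟨
        r ^ suc i * t    ∎

      bracket-1t : ∀ i j → bracket F p 1# t i j ≈ (r ^ j - r ^ i) * t
      bracket-1t i j = begin
        φ i 1# * φ j t - φ j 1# * φ i t      ≈⟨ +-cong (*-cong (φ-1 i) (φ-t j)) (-‿cong (*-cong (φ-1 j) (φ-t i))) ⟩
        1# * (r ^ j * t) - 1# * (r ^ i * t)
          ≈⟨ solve 3 (λ a b t → con (+ 1) :* (a :* t) :- con (+ 1) :* (b :* t) := (a :- b) :* t) refl (r ^ j) (r ^ i) t ⟩
        (r ^ j - r ^ i) * t                  ∎

      isNu-1t : IsNu F p 1# t z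
      isNu-1t = denominator≉0 , +-inverseˡ-unique _ _ relation
        where
        [_,_] : ℕ → ℕ → Carrier
        [ i , j ] = bracket F p 1# t i j

        denominator≈ : [ 0 , 1 ] * [ 2 , 3 ] ≈ ((r - 1#) * (r - 1#)) * ((r * r) * (t * t))
        denominator≈ = trans (*-cong (bracket-1t 0 1) (bracket-1t 2 3))
          (solve 2 (λ r t → ((r :^ 1 :- r :^ 0) :* t) :* ((r :^ 3 :- r :^ 2) :* t)
                            := ((r :- con (+ 1)) :* (r :- con (+ 1))) :* ((r :* r) :* (t :* t))) refl r t)

        r-1≉0 : r - 1# ≉ 0#
        r-1≉0 r-1≈0 = r≉1 (x∙y⁻¹≈ε⇒x≈y r 1# r-1≈0)

        denominator≉0 : [ 0 , 1 ] * [ 2 , 3 ] ≉ 0#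
        denominator≉0 den≈0 = *-≉0 (*-≉0 r-1≉0 r-1≉0) (*-≉0 (*-≉0 r≉0 r≉0) (*-≉0 t≉0 t≉0))
                                   (trans (sym denominator≈) den≈0)

        relation : z * ([ 0 , 1 ] * [ 2 , 3 ]) + [ 0 , 2 ] * [ 1 , 3 ] ≈ 0#
        relation = begin
          z * ([ 0 , 1 ] * [ 2 , 3 ]) + [ 0 , 2 ] * [ 1 , 3 ]
            ≈⟨ +-cong (*-congˡ (*-cong (bracket-1t 0 1) (bracket-1t 2 3))) (*-cong (bracket-1t 0 2) (bracket-1t 1 3)) ⟩
          z * (((r ^ 1 - r ^ 0) * t) * ((r ^ 3 - r ^ 2) * t)) + ((r ^ 2 - r ^ 0) * t) * ((r ^ 3 - r ^ 1) * t)
            ≈⟨ solve 3 (λ z r t →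
                 z :* (((r :^ 1 :- r :^ 0) :* t) :* ((r :^ 3 :- r :^ 2) :* t))
                   :+ ((r :^ 2 :- r :^ 0) :* t) :* ((r :^ 3 :- r :^ 1) :* t)
                 := ((r :- con (+ 1)) :* (r :- con (+ 1)) :* r :* (t :* t))
                    :* (r :* r :+ (z :+ con (+ 2)) :* r :+ con (+ 1)))
               refl z r t ⟩
          ((r - 1#) * (r - 1#) * r * (t * t)) * (r * r + (z + nat F 2) * r + 1#)
            ≈⟨ trans (*-congˡ quad) (zeroʳ _) ⟩
          0# ∎

      tᵖ≉t : t ^ p ≉ t
      tᵖ≉t tᵖ≈t = r≉1 (*-cancelʳ t≉0 (trans (sym tᵖ≈rt) (trans tᵖ≈t (sym (*-identityˡ t)))))

      t∈Fpᵐ : ∀ m → r ^ m ≈ 1# → InFpm F p m t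
      t∈Fpᵐ m rᵐ≈1 = trans (φ-t m) (trans (*-congʳ rᵐ≈1) (*-identityˡ t))

    rᵐ≈1⇒z∈Z : IsAlgClosed F → r ≉ 1# → ∀ m → r ^ m ≈ 1# → InZ F p m z
    rᵐ≈1⇒z∈Z algClosed r≉1 m rᵐ≈1 with algClosed⇒root algClosed r (p ∸ 2)
    ... | t , t^[1+p-2]≈r =
      1# , t , φ-1 m , t∈Fpᵐ r≉1 tᵖ⁻¹≈r m rᵐ≈1 , linIndep-1 (tᵖ≉t r≉1 tᵖ⁻¹≈r) , isNu-1t r≉1 tᵖ⁻¹≈r
      where
      tᵖ⁻¹≈r : t ^ ℕ.pred p ≈ r
      tᵖ⁻¹≈r = trans (reflexive (≡.cong (t ^_) (ℕ.+-∸-assoc 1 (nonTrivial⇒n>1 p)))) t^[1+p-2]≈r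

    IsNuOrbit : Carrier → Set ℓ
    IsNuOrbit w = z * (φ 0 w * φ 2 w) + (φ 1 w + φ 0 w) * (φ 2 w + φ 1 w) ≈ 0#

    module Orbit {w : Carrier} (w≉0 : w ≉ 0#) (orbit : IsNuOrbit w) where

      W : ℕ → Carrier
      W i = φ i w

      orbit-at : ∀ i → z * (W i * W (2 ℕ.+ i)) + (W (1 ℕ.+ i) + W i) * (W (2 ℕ.+ i) + W (1 ℕ.+ i)) ≈ 0#
      orbit-at i = begin
        z * (W i * W (2 ℕ.+ i)) + (W (1 ℕ.+ i) + W i) * (W (2 ℕ.+ i) + W (1 ℕ.+ i))
          ≈⟨ +-cong (*-cong (InPrimeField-φ z∈Fp i) (*-cong (φ-φ i 0 w) (φ-φ i 2 w)))
                    (*-cong (+-cong (φ-φ i 1 w) (φ-φ i 0 w)) (+-cong (φ-φ i 2 w) (φ-φ i 1 w))) ⟨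
        φ i z * (φ i (W 0) * φ i (W 2)) + (φ i (W 1) + φ i (W 0)) * (φ i (W 2) + φ i (W 1))
          ≈⟨ +-cong (trans (φ-* i _ _) (*-congˡ (φ-* i _ _))) (trans (φ-* i _ _) (*-cong (φ-+ i _ _) (φ-+ i _ _))) ⟨
        φ i (z * (W 0 * W 2)) + φ i ((W 1 + W 0) * (W 2 + W 1))
          ≈⟨ φ-+ i _ _ ⟨
        φ i (z * (W 0 * W 2) + (W 1 + W 0) * (W 2 + W 1))
          ≈⟨ trans (φ-cong i orbit) (φ-nat i 0) ⟩
        0# ∎

      A B : ℕ → Carrier
      A i = W (suc i) - r * W i
      B i = r * W (suc i) - W i

      A-φ : ∀ i → φ i (A 0) ≈ A i
      A-φ i = trans (φ-- i _ _)
        (+-cong (φ-φ i 1 w) (-‿cong (trans (φ-* i r _) (*-cong (InPrimeField-φ r∈Fp i) (φ-φ i 0 w)))))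

      B-φ : ∀ i → φ i (B 0) ≈ B i
      B-φ i = trans (φ-- i _ _)
        (+-cong (trans (φ-* i r _) (*-cong (InPrimeField-φ r∈Fp i) (φ-φ i 1 w))) (-‿cong (φ-φ i 0 w)))

      A-B-step : ∀ i → A (suc i) * B i ≈ r * (A i * B (suc i))
      A-B-step i = x∙y⁻¹≈ε⇒x≈y _ _ (begin
        A (suc i) * B i - r * (A i * B (suc i))
          ≈⟨ solve 5 (λ a b c r z →
               (c :- r :* b) :* (r :* b :- a) :- r :* ((b :- r :* a) :* (r :* c :- b))
               := r :* (con (+ 1) :- r) :* (z :* (a :* c) :+ (b :+ a) :* (c :+ b))
                  :+ a :* c :* (r :- con (+ 1)) :* (r :* r :+ (z :+ con (+ 2)) :* r :+ con (+ 1)))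
             refl (W i) (W (1 ℕ.+ i)) (W (2 ℕ.+ i)) r z ⟩
        r * (1# - r) * (z * (W i * W (2 ℕ.+ i)) + (W (1 ℕ.+ i) + W i) * (W (2 ℕ.+ i) + W (1 ℕ.+ i)))
          + W i * W (2 ℕ.+ i) * (r - 1#) * (r * r + (z + nat F 2) * r + 1#)
          ≈⟨ +-cong (*-congˡ (orbit-at i)) (*-congˡ quad) ⟩
        r * (1# - r) * 0# + W i * W (2 ℕ.+ i) * (r - 1#) * 0#
          ≈⟨ trans (+-cong (zeroʳ _) (zeroʳ _)) (+-identityʳ 0#) ⟩
        0# ∎)

      W₀≉0 : W 0 ≉ 0#
      W₀≉0 = φ-≉0 0 w≉0

      module _ {k : ℕ} (periodic : φ k w ≈ w) where

        Wₖ≈W₀ : W k ≈ W 0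
        Wₖ≈W₀ = trans periodic (sym (φ-zero w))

        Wₖ₊₁≈W₁ : W (suc k) ≈ W 1
        Wₖ₊₁≈W₁ = trans (sym (φ-φ k 1 w)) (trans (φ-comm k 1 w) (φ-cong 1 periodic))

        A₀≈0⇒rᵏ≈1 : A 0 ≈ 0# → r ^ k ≈ 1#
        A₀≈0⇒rᵏ≈1 A₀≈0 = *-cancelʳ W₀≉0 (begin
          r ^ k * W 0  ≈⟨ W≈rⁱW₀ k ⟨
          W k          ≈⟨ Wₖ≈W₀ ⟩
          W 0          ≈⟨ *-identityˡ _ ⟨
          1# * W 0     ∎)
          where
          Wᵢ₊₁≈rWᵢ : ∀ i → W (suc i) ≈ r * W i
          Wᵢ₊₁≈rWᵢ i = x∙y⁻¹≈ε⇒x≈y _ _ (trans (sym (A-φ i)) (trans (φ-cong i A₀≈0) (φ-nat i 0)))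

          W≈rⁱW₀ : ∀ i → W i ≈ r ^ i * W 0
          W≈rⁱW₀ zero    = sym (*-identityˡ _)
          W≈rⁱW₀ (suc i) = begin
            W (suc i)          ≈⟨ Wᵢ₊₁≈rWᵢ i ⟩
            r * W i            ≈⟨ *-congˡ (W≈rⁱW₀ i) ⟩
            r * (r ^ i * W 0)  ≈⟨ *-assoc r _ _ ⟨
            r ^ suc i * W 0    ∎

        B₀≈0⇒rᵏ≈1 : B 0 ≈ 0# → r ^ k ≈ 1#
        B₀≈0⇒rᵏ≈1 B₀≈0 = *-cancelʳ W₀≉0 (begin
          r ^ k * W 0  ≈⟨ *-congˡ Wₖ≈W₀ ⟨
          r ^ k * W k  ≈⟨ W₀≈rⁱWᵢ k ⟨
          W 0          ≈⟨ *-identityˡ _ ⟨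
          1# * W 0     ∎)
          where
          rWᵢ₊₁≈Wᵢ : ∀ i → r * W (suc i) ≈ W i
          rWᵢ₊₁≈Wᵢ i = x∙y⁻¹≈ε⇒x≈y _ _ (trans (sym (B-φ i)) (trans (φ-cong i B₀≈0) (φ-nat i 0)))

          W₀≈rⁱWᵢ : ∀ i → W 0 ≈ r ^ i * W i
          W₀≈rⁱWᵢ zero    = sym (*-identityˡ _)
          W₀≈rⁱWᵢ (suc i) = begin
            W 0                      ≈⟨ W₀≈rⁱWᵢ i ⟩
            r ^ i * W i              ≈⟨ *-congˡ (rWᵢ₊₁≈Wᵢ i) ⟨
            r ^ i * (r * W (suc i))  ≈⟨ solve 3 (λ a r b → a :* (r :* b) := (r :* a) :* b) refl (r ^ i) r (W (suc i)) ⟩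
            r ^ suc i * W (suc i)    ∎

        A₀,B₀≉0⇒rᵏ≈1 : A 0 ≉ 0# → B 0 ≉ 0# → r ^ k ≈ 1#
        A₀,B₀≉0⇒rᵏ≈1 A₀≉0 B₀≉0 = *-cancelʳ (*-≉0 A₀≉0 B₀≉0) (begin
          r ^ k * (A 0 * B 0)  ≈⟨ *-congˡ (*-congˡ Bₖ≈B₀) ⟨
          r ^ k * (A 0 * B k)  ≈⟨ AᵢB₀≈rⁱA₀Bᵢ k ⟨
          A k * B 0            ≈⟨ *-congʳ Aₖ≈A₀ ⟩
          A 0 * B 0            ≈⟨ *-identityˡ _ ⟨
          1# * (A 0 * B 0)     ∎)
          where
          Aₖ≈A₀ : A k ≈ A 0
          Aₖ≈A₀ = +-cong Wₖ₊₁≈W₁ (-‿cong (*-congˡ Wₖ≈W₀))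

          Bₖ≈B₀ : B k ≈ B 0
          Bₖ≈B₀ = +-cong (*-congˡ Wₖ₊₁≈W₁) (-‿cong Wₖ≈W₀)

          Bᵢ≉0 : ∀ i → B i ≉ 0#
          Bᵢ≉0 i Bᵢ≈0 = φ-≉0 i B₀≉0 (trans (B-φ i) Bᵢ≈0)

          AᵢB₀≈rⁱA₀Bᵢ : ∀ i → A i * B 0 ≈ r ^ i * (A 0 * B i)
          AᵢB₀≈rⁱA₀Bᵢ zero    = sym (*-identityˡ _)
          AᵢB₀≈rⁱA₀Bᵢ (suc i) = *-cancelʳ (Bᵢ≉0 i) (begin
            A (suc i) * B 0 * B i
              ≈⟨ solve 3 (λ a b c → a :* b :* c := a :* c :* b) refl (A (suc i)) (B 0) (B i) ⟩
            A (suc i) * B i * B 0                    ≈⟨ *-congʳ (A-B-step i) ⟩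
            r * (A i * B (suc i)) * B 0
              ≈⟨ solve 4 (λ r a b c → r :* (a :* b) :* c := r :* b :* (a :* c)) refl r (A i) (B (suc i)) (B 0) ⟩
            r * B (suc i) * (A i * B 0)              ≈⟨ *-congˡ (AᵢB₀≈rⁱA₀Bᵢ i) ⟩
            r * B (suc i) * (r ^ i * (A 0 * B i))
              ≈⟨ solve 5 (λ r b q a c → r :* b :* (q :* (a :* c)) := (r :* q) :* (a :* b) :* c)
                         refl r (B (suc i)) (r ^ i) (A 0) (B i) ⟩
            r ^ suc i * (A 0 * B (suc i)) * B i      ∎)

        -- Whether A₀ or B₀ vanishes is not decidable, but rᵏ ≈ 1# is, since r ∈ 𝔽ₚ.
        periodic⇒rᵏ≈1 : r ^ k ≈ 1#
        periodic⇒rᵏ≈1 = decidable-stable (^≈1? r∈Fp k) λ rᵏ≉1 →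
          rᵏ≉1 (A₀,B₀≉0⇒rᵏ≈1 (λ A₀≈0 → rᵏ≉1 (A₀≈0⇒rᵏ≈1 A₀≈0)) (λ B₀≈0 → rᵏ≉1 (B₀≈0⇒rᵏ≈1 B₀≈0)))

    module Quotient {x y u : Carrier} (xu≈1 : x * u ≈ 1#) where

      Y : Carrier
      Y = y * u

      D : ℕ → ℕ → Carrier
      D i j = φ j Y - φ i Y

      w : Carrier
      w = D 0 1

      x≉0 : x ≉ 0#
      x≉0 x≈0 = 1≉0 (trans (sym xu≈1) (trans (*-congʳ x≈0) (zeroˡ u)))

      φx*φu≈1 : ∀ i → φ i x * φ i u ≈ 1#
      φx*φu≈1 i = trans (sym (φ-* i x u)) (trans (φ-cong i xu≈1) (φ-1 i))

      bracket≈ : ∀ i j → bracket F p x y i j ≈ (φ i x * φ j x) * D i j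
      bracket≈ i j = sym (begin
        (φ i x * φ j x) * (φ j Y - φ i Y)
          ≈⟨ *-congˡ (+-cong (φ-* j y u) (-‿cong (φ-* i y u))) ⟩
        (φ i x * φ j x) * (φ j y * φ j u - φ i y * φ i u)
          ≈⟨ solve 6 (λ xi xj yi yj ui uj → (xi :* xj) :* (yj :* uj :- yi :* ui)
                                           := xi :* yj :* (xj :* uj) :- xj :* yi :* (xi :* ui))
               refl (φ i x) (φ j x) (φ i y) (φ j y) (φ i u) (φ j u) ⟩
        φ i x * φ j y * (φ j x * φ j u) - φ j x * φ i y * (φ i x * φ i u)
          ≈⟨ +-cong (trans (*-congˡ (φx*φu≈1 j)) (*-identityʳ _)) (-‿cong (trans (*-congˡ (φx*φu≈1 i)) (*-identityʳ _))) ⟩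
        φ i x * φ j y - φ j x * φ i y ∎)

      D-step : ∀ i → D i (suc i) ≈ φ i w
      D-step i = sym (trans (φ-- i _ _) (+-cong (φ-φ i 1 Y) (-‿cong (φ-φ i 0 Y))))

      D-split : ∀ i j k → D i k ≈ D j k + D i j
      D-split i j k = solve 3 (λ a b c → c :- a := (c :- b) :+ (b :- a)) refl (φ i Y) (φ j Y) (φ k Y)

      isNu⇒orbit : IsNu F p x y z → w ≉ 0# × IsNuOrbit w
      isNu⇒orbit (den≉0 , z*den≈-num) = w≉0 , (begin
        z * (φ 0 w * φ 2 w) + (φ 1 w + φ 0 w) * (φ 2 w + φ 1 w)
          ≈⟨ +-cong (*-congˡ (*-cong (D-step 0) (D-step 2)))
                    (*-cong (trans (D-split 0 1 2) (+-cong (D-step 1) (D-step 0)))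
                            (trans (D-split 1 2 3) (+-cong (D-step 2) (D-step 1)))) ⟨
        z * (D 0 1 * D 2 3) + D 0 2 * D 1 3
          ≈⟨ +-congʳ cancelled ⟩
        - (D 0 2 * D 1 3) + D 0 2 * D 1 3
          ≈⟨ -‿inverseˡ _ ⟩
        0# ∎)
        where
        P : Carrier
        P = (φ 0 x * φ 1 x) * (φ 2 x * φ 3 x)

        P≉0 : P ≉ 0#
        P≉0 = *-≉0 (*-≉0 (φ-≉0 0 x≉0) (φ-≉0 1 x≉0)) (*-≉0 (φ-≉0 2 x≉0) (φ-≉0 3 x≉0))

        den≈ : bracket F p x y 0 1 * bracket F p x y 2 3 ≈ (D 0 1 * D 2 3) * P
        den≈ = trans (*-cong (bracket≈ 0 1) (bracket≈ 2 3))
          (solve 6 (λ a b c d e f → ((a :* b) :* e) :* ((c :* d) :* f) := (e :* f) :* ((a :* b) :* (c :* d)))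
                 refl _ _ _ _ _ _)

        num≈ : bracket F p x y 0 2 * bracket F p x y 1 3 ≈ (D 0 2 * D 1 3) * P
        num≈ = trans (*-cong (bracket≈ 0 2) (bracket≈ 1 3))
          (solve 6 (λ a b c d e f → ((a :* c) :* e) :* ((b :* d) :* f) := (e :* f) :* ((a :* b) :* (c :* d)))
                 refl _ _ _ _ _ _)

        cancelled : z * (D 0 1 * D 2 3) ≈ - (D 0 2 * D 1 3)
        cancelled = *-cancelʳ P≉0 (begin
          z * (D 0 1 * D 2 3) * P                       ≈⟨ *-assoc _ _ _ ⟩
          z * ((D 0 1 * D 2 3) * P)                     ≈⟨ *-congˡ den≈ ⟨
          z * (bracket F p x y 0 1 * bracket F p x y 2 3) ≈⟨ z*den≈-num ⟩
          - (bracket F p x y 0 2 * bracket F p x y 1 3) ≈⟨ -‿cong num≈ ⟩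
          - ((D 0 2 * D 1 3) * P)                       ≈⟨ -‿distribˡ-* _ _ ⟩
          - (D 0 2 * D 1 3) * P                         ∎)

        w≉0 : w ≉ 0#
        w≉0 w≈0 = den≉0 (trans den≈ (trans (*-congʳ (trans (*-congʳ w≈0) (zeroˡ _))) (zeroˡ P)))

      fixed⇒periodic : ∀ {k} → φ k x ≈ x → φ k y ≈ y → φ k w ≈ w
      fixed⇒periodic {k} φₖx≈x φₖy≈y = begin
        φ k (φ 1 Y - φ 0 Y)          ≈⟨ φ-- k _ _ ⟩
        φ k (φ 1 Y) - φ k (φ 0 Y)    ≈⟨ +-cong (φ-comm k 1 Y) (-‿cong (φ-comm k 0 Y)) ⟩
        φ 1 (φ k Y) - φ 0 (φ k Y)    ≈⟨ +-cong (φ-cong 1 φₖY≈Y) (-‿cong (φ-cong 0 φₖY≈Y)) ⟩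
        φ 1 Y - φ 0 Y                ∎
        where
        φₖu≈u : φ k u ≈ u
        φₖu≈u = *-cancelˡ x≉0 (trans (*-congʳ (sym φₖx≈x)) (trans (φx*φu≈1 k) (sym xu≈1)))
        φₖY≈Y : φ k Y ≈ Y
        φₖY≈Y = trans (φ-* k y u) (*-cong φₖy≈y φₖu≈u)

    z∈Z⇒rᵏ≈1 : ∀ k → InZ F p k z → r ^ k ≈ 1#
    z∈Z⇒rᵏ≈1 k (x , y , φₖx≈x , φₖy≈y , linIndep , isNu) with proj₂ isField x (linIndep⇒≉0 linIndep)
    ... | u , xu≈1 =
      Orbit.periodic⇒rᵏ≈1 (proj₁ w≉0∧orbit) (proj₂ w≉0∧orbit) {k} (fixed⇒periodic {k} φₖx≈x φₖy≈y)
      where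
      open Quotient xu≈1
      w≉0∧orbit : w ≉ 0# × IsNuOrbit w
      w≉0∧orbit = isNu⇒orbit isNu

    order⇒appearance : IsAlgClosed F → z ≉ 0# → z ≉ - nat F 4 → ∀ m → IsMultOrder F r m → IsOrderOfAppearance F p z m
    order⇒appearance algClosed z≉0 z≉-4 m (1≤m , rᵐ≈1 , least) =
      1≤m , (z≉0 , rᵐ≈1⇒z∈Z algClosed (r≉1 z≉-4) m rᵐ≈1) ,
      λ k 1≤k (_ , z∈Zₖ) → least k 1≤k (z∈Z⇒rᵏ≈1 k z∈Zₖ)


theorem9p5 : ∀ {c ℓ : Level} (F : CommutativeRing c ℓ) (p : ℕ) → Prime p → ¬ (p ≡ 2) →
    IsAlgClosedFieldOfChar F p →
    let open CommutativeRing F in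
    ∀ (z s : Carrier) → InFp F p z → ¬ (z ≈ 0#) → ¬ (z ≈ - nat F 4) →
    InFp F p s → s * s ≈ z * z + nat F 4 * z →
    ∀ (r : Carrier) →
      (nat F 2 * r ≈ - (z + nat F 2) + s ⊎ nat F 2 * r ≈ - (z + nat F 2) - s) →
      ∃ λ m → IsMultOrder F r m × IsOrderOfAppearance F p z m
theorem9p5 F p p-prime p≢2 (isField , algClosed , char) z s z∈Fₚ z≉0 z≉-4 s∈Fₚ s²≈z²+4z r 2r≈ =
  let m , order = order-of-r in m , order , order⇒appearance algClosed z≉0 z≉-4 m order
  where
  open CommutativeRing F
  open OrderOfAppearance F p-prime isField char

  z∈Fp : InPrimeField z
  z∈Fp = InFp⇒InPrimeField z∈Fₚ

  -[z+2]∈Fp : InPrimeField (- (z + nat F 2))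
  -[z+2]∈Fp = InPrimeField-‿ (InPrimeField-+ z∈Fp (InPrimeField-nat 2))

  r∈Fp : InPrimeField r
  r∈Fp = Sum.[ InPrimeField-÷ (InPrimeField-+ -[z+2]∈Fp s∈Fp) (InPrimeField-nat 2) (nat2≉0 p≢2)
             , InPrimeField-÷ (InPrimeField-+ -[z+2]∈Fp (InPrimeField-‿ s∈Fp)) (InPrimeField-nat 2) (nat2≉0 p≢2) ]′ 2r≈
    where
    s∈Fp : InPrimeField s
    s∈Fp = InFp⇒InPrimeField s∈Fₚ

  open Root z r z∈Fp r∈Fp (quadratic-formula (nat2≉0 p≢2) s²≈z²+4z 2r≈)

  order-of-r : ∃ λ m → IsMultOrder F r m
  order-of-r = least-positive (^≈1? r∈Fp) (ℕ.pred p) p-1>0 (fermat r∈Fp r≉0)
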